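{- Let $U\le\mathrm{Sym}(\Delta)$ be primitive of type (C), $V\le\mathrm{Sym}(J)$, and let $G\le U\wr_J V$ be transitive on $\Delta\times J$, surjecting onto $V$, with each block stabilizer mapping onto $U$ via its action on its block. Let $G_1\le G$ be a point stabilizer and $G_1\le G_0\le G$ the stabilizer of the block containing that point. Assume $K:=\bigcap_{g\in G}G_0^g\ne 1$. Then for every minimal normal subgroup $N$ of $G$ with $N\cap K=1$, $G_1N$ is a proper subgroup of $G_0N$, and neither of $G_1N$ and $G_0$ contains the other.
   Context: $U\wr_J V=U^J\rtimes V$ acts imprimitively on $\Delta\times J$ with blocks $\Delta\times\{j\}$. A primitive group is of type (C) if its socle is isomorphic to $L^t$ for a nonabelian simple group $L$ and is its unique minimal normal subgroup. -}

module Defs where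

open import Level using (0ℓ)
open import Data.Nat using (ℕ)
open import Data.Fin using (Fin)
open import Data.Product using (Σ; ∃; _×_; _,_; proj₁; proj₂)
open import Data.Sum using (_⊎_)
open import Relation.Nullary using (¬_)
open import Relation.Binary.PropositionalEquality using (_≡_)
open import Algebra.Bundles using (Group)

record Perm (X : Set) : Set where
  field
    to      : X → X
    from    : X → X
    from-to : ∀ x → from (to x) ≡ x
    to-from : ∀ x → to (from x) ≡ x
open Perm public

module _ {X : Set} where

  _≈ₚ_ : Perm X → Perm X → Set
  g ≈ₚ h = ∀ x → to g x ≡ to h x

  idP : Perm X
  idP = record { to = λ x → x ; from = λ x → x
               ; from-to = λ x → Relation.Binary.PropositionalEquality.refl
               ; to-from = λ x → Relation.Binary.PropositionalEquality.refl }

  _∘ₚ_ : Perm X → Perm X → Perm X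
  g ∘ₚ h = record
    { to = λ x → to g (to h x)
    ; from = λ x → from h (from g x)
    ; from-to = λ x → Relation.Binary.PropositionalEquality.trans
        (Relation.Binary.PropositionalEquality.cong (from h) (from-to g (to h x))) (from-to h x)
    ; to-from = λ x → Relation.Binary.PropositionalEquality.trans
        (Relation.Binary.PropositionalEquality.cong (to g) (to-from h (from g x))) (to-from g x) }

  invP : Perm X → Perm X
  invP g = record { to = from g ; from = to g ; from-to = to-from g ; to-from = from-to g }

PSet : Set → Set₁
PSet X = Perm X → Set

module _ {X : Set} where

  _⊆ₚ_ : PSet X → PSet X → Set
  A ⊆ₚ B = ∀ g → A g → B g

  _∩ₚ_ : PSet X → PSet X → PSet X
  (A ∩ₚ B) g = A g × B g

  _·ₚ_ : PSet X → PSet X → PSet X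
  (A ·ₚ B) g = ∃ λ a → ∃ λ b → A a × B b × (g ≈ₚ (a ∘ₚ b))

  record IsPermGroup (G : PSet X) : Set₁ where
    field
      resp : ∀ {g h} → g ≈ₚ h → G g → G h
      id∈  : G idP
      ∘∈   : ∀ {g h} → G g → G h → G (g ∘ₚ h)
      inv∈ : ∀ {g} → G g → G (invP g)

  Trivial : PSet X → Set
  Trivial A = ∀ g → A g → g ≈ₚ idP

  record IsNormal (N G : PSet X) : Set₁ where
    field
      group  : IsPermGroup N
      sub    : N ⊆ₚ G
      conj∈  : ∀ {g n} → G g → N n → N ((g ∘ₚ n) ∘ₚ invP g)

  record IsMinimalNormal (N G : PSet X) : Set₁ where
    field
      normal     : IsNormal N G
      nontrivial : ¬ Trivial N
      minimal    : ∀ M → IsNormal M G → M ⊆ₚ N → Trivial M ⊎ N ⊆ₚ M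

  IsTransitive : PSet X → Set
  IsTransitive G = ∀ x y → ∃ λ g → G g × to g x ≡ y

  -- G is primitive on X: transitive, and every G-invariant equivalence
  -- relation on X (i.e. block system) is trivial or universal
  record IsPrimitive (G : PSet X) : Set₁ where
    field
      transitive : IsTransitive G
      noBlocks   : (R : X → X → Set) →
                   (∀ x → R x x) → (∀ {x y} → R x y → R y x) →
                   (∀ {x y z} → R x y → R y z → R x z) →
                   (∀ g {x y} → G g → R x y → R (to g x) (to g y)) →
                   (∀ {x y} → R x y → x ≡ y) ⊎ (∀ x y → R x y)

module _ (L : Group 0ℓ 0ℓ) where
  open Group L

  record IsNormalSubgroupᴳ (P : Carrier → Set) : Set where
    field
      resp  : ∀ {x y} → x ≈ y → P x → P y
      ε∈    : P ε
      ∙∈    : ∀ {x y} → P x → P y → P (x ∙ y)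
      inv∈  : ∀ {x} → P x → P (x ⁻¹)
      conj∈ : ∀ g {x} → P x → P ((g ∙ x) ∙ g ⁻¹)

  record IsNonabelianSimple : Set₁ where
    field
      nonabelian : ∃ λ x → ∃ λ y → ¬ ((x ∙ y) ≈ (y ∙ x))
      nontrivial : ∃ λ x → ¬ (x ≈ ε)
      simple     : ∀ P → IsNormalSubgroupᴳ P →
                   (∀ x → P x → x ≈ ε) ⊎ (∀ x → P x)

module _ {X : Set} (M : PSet X) (L : Group 0ℓ 0ℓ) (t : ℕ) where
  open Group L

  _≈ᵗ_ : (Fin t → Carrier) → (Fin t → Carrier) → Set
  a ≈ᵗ b = ∀ i → a i ≈ b i

  record IsoToPower : Set where
    field
      φ      : (g : Perm X) → M g → (Fin t → Carrier)
      resp   : ∀ {g h} (p : M g) (q : M h) → g ≈ₚ h → φ g p ≈ᵗ φ h q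
      hom    : ∀ {g h} (p : M g) (q : M h) (r : M (g ∘ₚ h)) →
               φ (g ∘ₚ h) r ≈ᵗ (λ i → φ g p i ∙ φ h q i)
      inj    : ∀ {g h} (p : M g) (q : M h) → φ g p ≈ᵗ φ h q → g ≈ₚ h
      surj   : ∀ (a : Fin t → Carrier) → ∃ λ g → Σ (M g) λ p → φ g p ≈ᵗ a

record IsTypeC {X : Set} (U : PSet X) : Set₁ where
  field
    isPrimitive : IsPrimitive U
    soc       : PSet X
    socMin    : IsMinimalNormal soc U
    socUnique : ∀ M → IsMinimalNormal M U → (M ⊆ₚ soc) × (soc ⊆ₚ M)
    L         : Group 0ℓ 0ℓ
    Lsimple   : IsNonabelianSimple L
    t         : ℕ
    socIso    : IsoToPower soc L t

InWreath : ∀ {Δ J : Set} → PSet Δ → PSet J → PSet (Δ × J)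
InWreath {Δ} {J} U V g =
  ∃ λ (σ : Perm J) → V σ × ∃ λ (u : J → Perm Δ) → (∀ j → U (u j)) ×
    (∀ δ j → to g (δ , j) ≡ (to (u j) δ , to σ j))

module _ {Δ J : Set} (G : PSet (Δ × J)) where

  SurjectsOnto : PSet J → Set
  SurjectsOnto V = ∀ v → V v → ∃ λ g → G g × (∀ δ j → proj₂ (to g (δ , j)) ≡ to v j)

  BlockStabOnto : PSet Δ → Set
  BlockStabOnto U = ∀ j u → U u → ∃ λ g → G g × (∀ δ → to g (δ , j) ≡ (to u δ , j))

  PointStab : Δ → J → PSet (Δ × J)
  PointStab δ₀ j₀ g = G g × (to g (δ₀ , j₀) ≡ (δ₀ , j₀))

  BlockStab : J → PSet (Δ × J)
  BlockStab j₀ g = G g × (∀ δ → proj₂ (to g (δ , j₀)) ≡ j₀)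

Core : ∀ {X : Set} → PSet X → PSet X → PSet X
Core G H k = G k × (∀ g → G g → H ((invP g ∘ₚ k) ∘ₚ g))

module Submission where

-- Write G₀ = BlockStab G j₀, G₁ = PointStab G δ₀ j₀ and K = Core G G₀, and let
-- N be a minimal normal subgroup of G with N ∩ K = 1.  Three of the four claims
-- are elementary: G₁ ≤ G₀ gives G₁N ⊆ G₀N; G₁N ⊆ G₀ would put the normal
-- subgroup N inside G₀, hence inside K, so N = N ∩ K = 1; and G₀N ⊆ G₁N would
-- give G₀ ⊆ G₁N.  The heart of the proof excludes G₀ ⊆ G₁N.
--
-- Suppose G₀ ⊆ G₁N and let B ⊆ U be the permutations induced on the block
-- Δ × {j₀} by the elements of N stabilising it.  Then B is normalised by U, and
-- G₀ ⊆ G₁N makes B transitive on Δ.  Since [N , K] ≤ N ∩ K = 1, the group K acts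
-- on the block by elements centralising B, and K ≠ 1 forces this action to be
-- nontrivial; so C_U(B) ≠ 1.  But in a primitive group U of type (C), the
-- centraliser Z = C_U(B) of a transitive normal set is trivial: otherwise Z and
-- W = C_U(Z) ⊇ B are nontrivial normal subgroups centralising transitive sets,
-- hence regular, hence minimal normal, hence both equal to the nonabelian socle
-- L^t, which would then be abelian.

open import Defs
open import Data.Nat using (ℕ; zero; suc)
open import Data.Fin using (Fin) renaming (zero to fzero)
open import Data.Product using (_×_; _,_; proj₁; proj₂; ∃)
open import Data.Sum using (_⊎_; inj₁; inj₂)
open import Data.Empty using (⊥; ⊥-elim)
open import Relation.Nullary using (¬_)
open import Relation.Binary.PropositionalEquality using (_≡_; refl; sym; trans; cong; module ≡-Reasoning)
open import Level using (0ℓ)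
open import Algebra.Bundles using (Group)
import Relation.Binary.Reasoning.Setoid as SetoidReasoning

module _ {X : Set} where
  open ≡-Reasoning

  SemiregularAt : PSet X → X → Set
  SemiregularAt T x₀ = ∀ t → T t → to t x₀ ≡ x₀ → t ≈ₚ idP

  Reaches : PSet X → X → Set
  Reaches T x₀ = ∀ x → ∃ λ g → T g × to g x₀ ≡ x

  ConjInvariant : PSet X → PSet X → Set
  ConjInvariant U T = ∀ {u t} → U u → T t → T ((invP u ∘ₚ t) ∘ₚ u)

  Centraliser : PSet X → PSet X → PSet X
  Centraliser U S g = U g × (∀ s → S s → (g ∘ₚ s) ≈ₚ (s ∘ₚ g))

  -- If trivial permutations carry x₀ everywhere, X is a single point, so every
  -- permutation of X is trivial.
  reaching-trivial : {T : PSet X} {x₀ : X} → Reaches T x₀ → Trivial T → ∀ g → g ≈ₚ idP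
  reaching-trivial {T} {x₀} reach triv g x = trans (sym (x₀≡ (to g x))) (x₀≡ x)
    where
      x₀≡ : ∀ y → x₀ ≡ y
      x₀≡ y with reach y
      ... | t , Tt , e = trans (sym (triv t Tt x₀)) e

  commuting-semiregular : {S T : PSet X} {x₀ : X} → Reaches S x₀ →
                          (∀ t s → T t → S s → (t ∘ₚ s) ≈ₚ (s ∘ₚ t)) → SemiregularAt T x₀
  commuting-semiregular {x₀ = x₀} reach comm t Tt fix x with reach x
  ... | s , Ss , refl = trans (comm t s Tt Ss x₀) (cong (to s) fix)

  module _ {U : PSet X} (gU : IsPermGroup U) where
    open IsPermGroup gU

    normal-conjInvariant : {M : PSet X} → IsNormal M U → ConjInvariant U M
    normal-conjInvariant nM Uu Mt =
      IsPermGroup.resp (IsNormal.group nM) (λ x → refl) (IsNormal.conj∈ nM (inv∈ Uu) Mt)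

    normal-in-core : {M H : PSet X} → IsNormal M U → M ⊆ₚ H → M ⊆ₚ Core U H
    normal-in-core nM M⊆H m Mm =
      IsNormal.sub nM m Mm , λ u Uu → M⊆H _ (normal-conjInvariant nM Uu Mm)

    centraliser-group : (S : PSet X) → IsPermGroup (Centraliser U S)
    centraliser-group S = record
      { resp = λ {g} e (Ug , comm) → resp e Ug , λ s Ss x →
          trans (sym (e (to s x))) (trans (comm s Ss x) (cong (to s) (e x)))
      ; id∈ = id∈ , λ s Ss x → refl
      ; ∘∈ = λ {g} {h} (Ug , commg) (Uh , commh) → ∘∈ Ug Uh , λ s Ss x →
          trans (cong (to g) (commh s Ss x)) (commg s Ss (to h x))
      ; inv∈ = λ {g} (Ug , comm) → inv∈ Ug , λ s Ss x → begin
          from g (to s x)                 ≡⟨ cong (λ y → from g (to s y)) (to-from g x) ⟨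
          from g (to s (to g (from g x))) ≡⟨ cong (from g) (comm s Ss (from g x)) ⟨
          from g (to g (to s (from g x))) ≡⟨ from-to g _ ⟩
          to s (from g x)                 ∎
      }

    centraliser-normal : (S : PSet X) → ConjInvariant U S → IsNormal (Centraliser U S) U
    centraliser-normal S conjS = record
      { group = centraliser-group S
      ; sub = λ g → proj₁
      ; conj∈ = λ {u} {c} Uu (Uc , comm) → ∘∈ (∘∈ Uu Uc) (inv∈ Uu) , λ s Ss x → begin
          to u (to c (from u (to s x)))
            ≡⟨ cong (λ y → to u (to c (from u (to s y)))) (to-from u x) ⟨
          to u (to c (from u (to s (to u (from u x)))))
            ≡⟨ cong (to u) (comm _ (conjS Uu Ss) (from u x)) ⟩
          to u (from u (to s (to u (to c (from u x)))))
            ≡⟨ to-from u _ ⟩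
          to s (to u (to c (from u x)))
            ∎
      }

    module _ (prim : IsPrimitive U) where

      -- The orbits of a normal subgroup form a U-invariant partition, so by
      -- primitivity a normal subgroup is trivial or transitive.
      normal-trivial-or-transitive : {M : PSet X} → IsNormal M U → Trivial M ⊎ IsTransitive M
      normal-trivial-or-transitive {M} nM
        with IsPrimitive.noBlocks prim Orbit (λ x → idP , M.id∈ , refl) symmetric transitive invariant
        where
          module M = IsPermGroup (IsNormal.group nM)
          Orbit : X → X → Set
          Orbit x y = ∃ λ g → M g × to g x ≡ y
          symmetric : ∀ {x y} → Orbit x y → Orbit y x
          symmetric {x} (g , Mg , e) = invP g , M.inv∈ Mg , trans (cong (from g) (sym e)) (from-to g x)
          transitive : ∀ {x y z} → Orbit x y → Orbit y z → Orbit x z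
          transitive (g , Mg , e) (h , Mh , e') = h ∘ₚ g , M.∘∈ Mh Mg , trans (cong (to h) e) e'
          invariant : ∀ u {x y} → U u → Orbit x y → Orbit (to u x) (to u y)
          invariant u {x} Uu (g , Mg , e) =
            (u ∘ₚ g) ∘ₚ invP u , IsNormal.conj∈ nM Uu Mg , cong (to u) (trans (cong (to g) (from-to u x)) e)
      ... | inj₁ discrete = inj₁ λ g Mg x → sym (discrete (g , Mg , refl))
      ... | inj₂ universal = inj₂ universal

      -- A nontrivial semiregular normal subgroup Z is minimal normal: a
      -- nontrivial normal subgroup M ⊆ Z is transitive, and then every z ∈ Z
      -- agrees with the m ∈ M having m x₀ = z x₀.
      regular-normal-minimal : {Z : PSet X} {x₀ : X} → IsNormal Z U → ¬ Trivial Z →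
                               SemiregularAt Z x₀ → IsMinimalNormal Z U
      regular-normal-minimal {Z} {x₀} nZ ntZ semireg =
        record { normal = nZ ; nontrivial = ntZ ; minimal = minimal }
        where
          module Z = IsPermGroup (IsNormal.group nZ)
          absorbed : ∀ {M} → IsNormal M U → M ⊆ₚ Z → ∀ z → Z z →
                     (∃ λ m → M m × to m x₀ ≡ to z x₀) → M z
          absorbed nM M⊆Z z Zz (m , Mm , e) = IsPermGroup.resp (IsNormal.group nM) m≈z Mm
            where
              m⁻¹z≈id : (invP m ∘ₚ z) ≈ₚ idP
              m⁻¹z≈id = semireg _ (Z.∘∈ (Z.inv∈ (M⊆Z m Mm)) Zz)
                          (trans (cong (from m) (sym e)) (from-to m x₀))
              m≈z : m ≈ₚ z
              m≈z x = trans (cong (to m) (sym (m⁻¹z≈id x))) (to-from m (to z x))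
          minimal : ∀ M → IsNormal M U → M ⊆ₚ Z → Trivial M ⊎ Z ⊆ₚ M
          minimal M nM M⊆Z with normal-trivial-or-transitive nM
          ... | inj₁ trivial = inj₁ trivial
          ... | inj₂ trM = inj₂ λ z Zz → absorbed nM M⊆Z z Zz (trM x₀ (to z x₀))

-- A nontrivial permutation group isomorphic to L^t with L nonabelian is
-- nonabelian: t ≠ 0, and in coordinate 0 two constant tuples (x) and (y) with
-- xy ≠ yx do not commute.
power-nonabelian : {X : Set} {S : PSet X} (L : Group 0ℓ 0ℓ) (t : ℕ) → IsPermGroup S → ¬ Trivial S →
                   IsNonabelianSimple L → IsoToPower S L t →
                   ¬ (∀ g h → S g → S h → (g ∘ₚ h) ≈ₚ (h ∘ₚ g))
power-nonabelian L zero gS ntS _ iso _ =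
  ntS λ g Sg → IsoToPower.inj iso Sg (IsPermGroup.id∈ gS) (λ ())
power-nonabelian L (suc t) gS _ simple iso comm = noncommuting (IsNonabelianSimple.nonabelian simple)
  where
    open Group L using (_∙_; _≈_; ∙-cong; setoid)
    open IsoToPower iso
    open IsPermGroup gS using (∘∈)
    open SetoidReasoning setoid
    noncommuting : (∃ λ x → ∃ λ y → ¬ ((x ∙ y) ≈ (y ∙ x))) → ⊥
    noncommuting (x , y , xy≉yx) with surj (λ _ → x) | surj (λ _ → y)
    ... | g , Sg , φg | h , Sh , φh = xy≉yx (begin
      x ∙ y                               ≈⟨ ∙-cong (φg fzero) (φh fzero) ⟨
      φ g Sg fzero ∙ φ h Sh fzero         ≈⟨ hom Sg Sh (∘∈ Sg Sh) fzero ⟨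
      φ (g ∘ₚ h) (∘∈ Sg Sh) fzero         ≈⟨ resp (∘∈ Sg Sh) (∘∈ Sh Sg) (comm g h Sg Sh) fzero ⟩
      φ (h ∘ₚ g) (∘∈ Sh Sg) fzero         ≈⟨ hom Sh Sg (∘∈ Sh Sg) fzero ⟩
      φ h Sh fzero ∙ φ g Sg fzero         ≈⟨ ∙-cong (φh fzero) (φg fzero) ⟩
      y ∙ x                               ∎)

module _ {X : Set} {U : PSet X} (gU : IsPermGroup U) (typeC : IsTypeC U) where
  open IsTypeC typeC

  -- Nontrivial semiregular normal subgroups of a group of type (C) are minimal
  -- normal, hence both equal to the nonabelian socle; so they cannot commute.
  typeC-no-commuting-regular-normals :
    {Z W : PSet X} (x₀ : X) → IsNormal Z U → IsNormal W U → ¬ Trivial Z → ¬ Trivial W →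
    SemiregularAt Z x₀ → SemiregularAt W x₀ → ¬ (∀ w z → W w → Z z → (w ∘ₚ z) ≈ₚ (z ∘ₚ w))
  typeC-no-commuting-regular-normals x₀ nZ nW ntZ ntW srZ srW comm =
    power-nonabelian L t (IsNormal.group (IsMinimalNormal.normal socMin))
      (IsMinimalNormal.nontrivial socMin) Lsimple socIso socAbelian
    where
      soc⊆Z = proj₂ (socUnique _ (regular-normal-minimal gU isPrimitive nZ ntZ srZ))
      soc⊆W = proj₂ (socUnique _ (regular-normal-minimal gU isPrimitive nW ntW srW))
      socAbelian : ∀ g h → soc g → soc h → (g ∘ₚ h) ≈ₚ (h ∘ₚ g)
      socAbelian g h Sg Sh = comm g h (soc⊆W g Sg) (soc⊆Z h Sh)

  -- In a group of type (C), a U-invariant set B ⊆ U reaching every point from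
  -- x₀ cannot have nontrivial centraliser: Z = C_U(B) and W = C_U(Z) ⊇ B would
  -- be commuting nontrivial normal subgroups, semiregular because they
  -- centralise B and the (transitive) Z respectively.
  typeC-centraliser-trivial : {B : PSet X} {x₀ : X} → B ⊆ₚ U → ConjInvariant U B → Reaches B x₀ →
                              ¬ ¬ Trivial (Centraliser U B)
  typeC-centraliser-trivial {B} {x₀} B⊆U conjB reachB ntZ =
    typeC-no-commuting-regular-normals x₀ nZ nW ntZ ntW srZ srW (λ w z (_ , comm) Zz → comm z Zz)
    where
      Z W : PSet X
      Z = Centraliser U B
      W = Centraliser U Z
      nZ : IsNormal Z U
      nZ = centraliser-normal gU B conjB
      nW : IsNormal W U
      nW = centraliser-normal gU Z (normal-conjInvariant gU nZ)
      B⊆W : B ⊆ₚ W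
      B⊆W b Bb = B⊆U b Bb , λ z (_ , comm) x → sym (comm b Bb x)
      ntW : ¬ Trivial W
      ntW trivW = ntZ λ z _ → reaching-trivial reachB (λ b Bb → trivW b (B⊆W b Bb)) z
      trZ : IsTransitive Z
      trZ with normal-trivial-or-transitive gU isPrimitive nZ
      ... | inj₁ trivZ = ⊥-elim (ntZ trivZ)
      ... | inj₂ transitive = transitive
      srZ : SemiregularAt Z x₀
      srZ = commuting-semiregular reachB (λ z b (_ , comm) Bb → comm b Bb)
      srW : SemiregularAt W x₀
      srW = commuting-semiregular (trZ x₀) (λ w z (_ , comm) Zz → comm z Zz)

FixesBlocks : {Δ J : Set} → Perm (Δ × J) → Set
FixesBlocks k = ∀ y → proj₂ (to k y) ≡ proj₂ y

NOnBlock : {Δ J : Set} → PSet Δ → PSet (Δ × J) → J → PSet Δ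
NOnBlock U N j₀ b = U b × ∃ λ n → N n × (∀ x → to n (x , j₀) ≡ (to b x , j₀))

module WreathBlocks {Δ J : Set} {U : PSet Δ} {V : PSet J} {G : PSet (Δ × J)} (wr : G ⊆ₚ InWreath U V) where
  open ≡-Reasoning

  blocks-preserved : ∀ {g} → G g → ∀ {y y'} → proj₂ y ≡ proj₂ y' → proj₂ (to g y) ≡ proj₂ (to g y')
  blocks-preserved {g} Gg {a , j} {a' , .j} refl with wr g Gg
  ... | _ , _ , _ , _ , act = trans (cong proj₂ (act a j)) (sym (cong proj₂ (act a' j)))

  block-action : ∀ {g} → G g → ∀ {δ₁ j j'} → proj₂ (to g (δ₁ , j)) ≡ j' →
                 ∃ λ u → U u × (∀ x → to g (x , j) ≡ (to u x , j'))
  block-action {g} Gg {δ₁} {j} e with wr g Gg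
  ... | _ , _ , u , Uu , act =
    u j , Uu j , λ x → trans (act x j) (cong (to (u j) x ,_) (trans (sym (cong proj₂ (act δ₁ j))) e))

  pointStab⊆blockStab : ∀ δ₀ j₀ → PointStab G δ₀ j₀ ⊆ₚ BlockStab G j₀
  pointStab⊆blockStab δ₀ j₀ g (Gg , fix) =
    Gg , λ δ → trans (blocks-preserved Gg {δ , j₀} {δ₀ , j₀} refl) (cong proj₂ fix)

  module _ (gG : IsPermGroup G) (j₀ : J) where
    open IsPermGroup gG

    private
      K : PSet (Δ × J)
      K = Core G (BlockStab G j₀)

    conj-fixesBlocks : ∀ {g k} → G g → FixesBlocks k → FixesBlocks ((invP g ∘ₚ k) ∘ₚ g)
    conj-fixesBlocks {g} {k} Gg fixes y =
      trans (blocks-preserved (inv∈ Gg) {to k (to g y)} {to g y} (fixes (to g y))) (cong proj₂ (from-to g y))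

    fixesBlocks⇒core : ∀ {k} → G k → FixesBlocks k → K k
    fixesBlocks⇒core {k} Gk fixes =
      Gk , λ g Gg → ∘∈ (∘∈ (inv∈ Gg) Gk) Gg , λ δ → conj-fixesBlocks {k = k} Gg fixes (δ , j₀)

    module _ (trG : IsTransitive G) where

      -- Conversely, as G permutes the blocks transitively, K fixes every block.
      core⇒fixesBlocks : ∀ {k} → K k → FixesBlocks k
      core⇒fixesBlocks {k} (_ , inG₀ᵍ) (δ , j) with trG (δ , j₀) (δ , j)
      ... | g , Gg , e = begin
        proj₂ (to k (δ , j))                 ≡⟨ cong proj₂ (to-from g _) ⟨
        proj₂ (to g (from g (to k (δ , j)))) ≡⟨ blocks-preserved Gg g⁻¹kg-fixes-j₀ ⟩
        proj₂ (to g (δ , j₀))                ≡⟨ cong proj₂ e ⟩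
        j                                    ∎
        where
          g⁻¹kg-fixes-j₀ : proj₂ (from g (to k (δ , j))) ≡ j₀
          g⁻¹kg-fixes-j₀ = trans (cong (λ y → proj₂ (from g (to k y))) (sym e)) (proj₂ (inG₀ᵍ g Gg) δ)

      core-conj : ∀ {k g} → K k → G g → K ((invP g ∘ₚ k) ∘ₚ g)
      core-conj {k} Kk Gg =
        fixesBlocks⇒core (∘∈ (∘∈ (inv∈ Gg) (proj₁ Kk)) Gg) (conj-fixesBlocks {k = k} Gg (core⇒fixesBlocks Kk))

      -- K acts faithfully on the block Δ × {j₀}: if it fixes that block
      -- pointwise, then (conjugating by G) it fixes every block pointwise.
      core-faithful-on-block : (∀ k → K k → ∀ δ → to k (δ , j₀) ≡ (δ , j₀)) → Trivial K
      core-faithful-on-block onBlock k Kk (δ , j) with trG (δ , j₀) (δ , j)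
      ... | g , Gg , e = begin
        to k (δ , j)                         ≡⟨ cong (to k) e ⟨
        to k (to g (δ , j₀))                 ≡⟨ to-from g _ ⟨
        to g (from g (to k (to g (δ , j₀)))) ≡⟨ cong (to g) (onBlock _ (core-conj Kk Gg) δ) ⟩
        to g (δ , j₀)                        ≡⟨ e ⟩
        (δ , j)                              ∎

      -- If N ⊴ G meets K trivially, N and K commute: the commutator
      -- n (k n⁻¹ k⁻¹) lies in N and fixes every block, so it lies in N ∩ K.
      core-commutes : {N : PSet (Δ × J)} → IsNormal N G → Trivial (N ∩ₚ K) →
                      ∀ {n k} → N n → K k → ∀ y → to n (to k y) ≡ to k (to n y)
      core-commutes {N} nN NK {n} {k} Nn Kk y = begin
        to n (to k y)                                    ≡⟨ cong (λ z → to n (to k z)) (from-to n y) ⟨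
        to n (to k (from n (to n y)))                    ≡⟨ cong (λ z → to n (to k (from n z))) (from-to k (to n y)) ⟨
        to n (to k (from n (from k (to k (to n y)))))    ≡⟨ NK commutator (Ncomm , Kcomm) (to k (to n y)) ⟩
        to k (to n y)                                    ∎
        where
          module N = IsPermGroup (IsNormal.group nN)
          commutator : Perm (Δ × J)
          commutator = n ∘ₚ ((k ∘ₚ invP n) ∘ₚ invP k)
          Ncomm : N commutator
          Ncomm = N.∘∈ Nn (IsNormal.conj∈ nN (proj₁ Kk) (N.inv∈ Nn))
          Kcomm : K commutator
          Kcomm = fixesBlocks⇒core (IsNormal.sub nN _ Ncomm) λ x →
            trans (conj-fixesBlocks {k = k} (inv∈ (IsNormal.sub nN n Nn)) (core⇒fixesBlocks Kk) (from k x))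
                  (trans (sym (core⇒fixesBlocks Kk (from k x))) (cong proj₂ (to-from k x)))

module _ {Δ J : Set} {U : PSet Δ} {V : PSet J} {G : PSet (Δ × J)}
         (gU : IsPermGroup U) (gG : IsPermGroup G) (wr : G ⊆ₚ InWreath U V) (onto : BlockStabOnto G U)
         {N : PSet (Δ × J)} (nN : IsNormal N G) (j₀ : J) where
  open ≡-Reasoning
  open IsPermGroup gU renaming (∘∈ to ∘∈U; inv∈ to inv∈U)
  module N = IsPermGroup (IsNormal.group nN)
  open WreathBlocks {U = U} {V = V} wr

  -- U normalises the action of N on the block: conjugation by u ∈ U is
  -- realised by an element of G₀ acting on the block as u⁻¹.
  nOnBlock-conjInvariant : ConjInvariant U (NOnBlock U N j₀)
  nOnBlock-conjInvariant {u} {b} Uu (Ub , n , Nn , nAct) with onto j₀ (invP u) (inv∈U Uu)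
  ... | g , Gg , gAct = ∘∈U (∘∈U (inv∈U Uu) Ub) Uu , (g ∘ₚ n) ∘ₚ invP g , IsNormal.conj∈ nN Gg Nn , λ x → begin
    to g (to n (from g (x , j₀))) ≡⟨ cong (λ y → to g (to n y)) (g⁻¹-on-block x) ⟩
    to g (to n (to u x , j₀))     ≡⟨ cong (to g) (nAct (to u x)) ⟩
    to g (to b (to u x) , j₀)     ≡⟨ gAct (to b (to u x)) ⟩
    (from u (to b (to u x)) , j₀) ∎
    where
      g⁻¹-on-block : ∀ x → from g (x , j₀) ≡ (to u x , j₀)
      g⁻¹-on-block x = begin
        from g (x , j₀)                 ≡⟨ cong (λ z → from g (z , j₀)) (from-to u x) ⟨
        from g (from u (to u x) , j₀)   ≡⟨ cong (from g) (gAct (to u x)) ⟨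
        from g (to g (to u x , j₀))     ≡⟨ from-to g _ ⟩
        (to u x , j₀)                   ∎

  module _ (trU : IsTransitive U) (δ₀ : Δ) (G₀⊆G₁N : BlockStab G j₀ ⊆ₚ (PointStab G δ₀ j₀ ·ₚ N)) where

    -- If G₀ ⊆ G₁N then N carries (δ₀, j₀) to every point of its block: write an
    -- element of G₀ moving (δ, j₀) to (δ₀, j₀) as p n with p ∈ G₁, n ∈ N.
    normal-reaches-block : ∀ δ → ∃ λ n → N n × to n (δ₀ , j₀) ≡ (δ , j₀)
    normal-reaches-block δ with trU δ δ₀
    ... | u , Uu , uδ≡δ₀ with onto j₀ u Uu
    ... | g , Gg , gAct with G₀⊆G₁N g (Gg , λ x → cong proj₂ (gAct x))
    ... | p , n , (_ , pFix) , Nn , g≈pn = invP n , N.inv∈ Nn , (begin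
      from n (δ₀ , j₀)              ≡⟨ cong (from n) n-moves ⟨
      from n (to n (δ , j₀))        ≡⟨ from-to n _ ⟩
      (δ , j₀)                      ∎)
      where
        n-moves : to n (δ , j₀) ≡ (δ₀ , j₀)
        n-moves = begin
          to n (δ , j₀)               ≡⟨ from-to p _ ⟨
          from p (to p (to n (δ , j₀))) ≡⟨ cong (from p) (g≈pn _) ⟨
          from p (to g (δ , j₀))      ≡⟨ cong (from p) (trans (gAct δ) (cong (_, j₀) uδ≡δ₀)) ⟩
          from p (δ₀ , j₀)            ≡⟨ cong (from p) pFix ⟨
          from p (to p (δ₀ , j₀))     ≡⟨ from-to p _ ⟩
          (δ₀ , j₀)                   ∎

    nOnBlock-reaches : Reaches (NOnBlock U N j₀) δ₀
    nOnBlock-reaches δ with normal-reaches-block δ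
    ... | n , Nn , e with block-action (IsNormal.sub nN n Nn) {δ₀} {j₀} {j₀} (cong proj₂ e)
    ... | b , Ub , act = b , (Ub , n , Nn , act) , cong proj₁ (trans (sym (act δ₀)) e)

  -- The permutation a ∈ U by which k ∈ K acts on the block centralises B,
  -- because k commutes with N.
  core-centralises-nOnBlock : IsTransitive G → Trivial (N ∩ₚ Core G (BlockStab G j₀)) →
                              ∀ {k a} → Core G (BlockStab G j₀) k → U a →
                              (∀ x → to k (x , j₀) ≡ (to a x , j₀)) → Centraliser U (NOnBlock U N j₀) a
  core-centralises-nOnBlock trG NK {k} {a} Kk Ua kAct = Ua , λ b (_ , n , Nn , nAct) x → cong proj₁ (begin
    (to a (to b x) , j₀)  ≡⟨ kAct (to b x) ⟨
    to k (to b x , j₀)    ≡⟨ cong (to k) (nAct x) ⟨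
    to k (to n (x , j₀))  ≡⟨ core-commutes gG j₀ trG nN NK Nn Kk (x , j₀) ⟨
    to n (to k (x , j₀))  ≡⟨ cong (to n) (kAct x) ⟩
    to n (to a x , j₀)    ≡⟨ nAct (to a x) ⟩
    (to b (to a x) , j₀)  ∎)

  -- Otherwise B is a transitive U-invariant subset
  -- of U whose centraliser contains the (faithful, nontrivial) action of K on
  -- the block, contradicting typeC-centraliser-trivial.
  blockStab⊈pointStab·N : IsTypeC U → IsTransitive G → (δ₀ : Δ) →
                          ¬ Trivial (Core G (BlockStab G j₀)) → Trivial (N ∩ₚ Core G (BlockStab G j₀)) →
                          ¬ (BlockStab G j₀ ⊆ₚ (PointStab G δ₀ j₀ ·ₚ N))
  blockStab⊈pointStab·N typeC trG δ₀ Knt NK G₀⊆G₁N =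
    typeC-centraliser-trivial gU typeC (λ _ → proj₁) nOnBlock-conjInvariant
      (nOnBlock-reaches (IsPrimitive.transitive (IsTypeC.isPrimitive typeC)) δ₀ G₀⊆G₁N)
      centraliser-nontrivial
    where
      centraliser-nontrivial : ¬ Trivial (Centraliser U (NOnBlock U N j₀))
      centraliser-nontrivial trivC = Knt (core-faithful-on-block gG j₀ trG trivial-on-block)
        where
          trivial-on-block : ∀ k → Core G (BlockStab G j₀) k → ∀ δ → to k (δ , j₀) ≡ (δ , j₀)
          trivial-on-block k Kk δ
            with block-action (proj₁ Kk) {δ₀} {j₀} {j₀} (core⇒fixesBlocks gG j₀ trG Kk (δ₀ , j₀))
          ... | a , Ua , act = trans (act δ) (cong (_, j₀) (trivC a (core-centralises-nOnBlock trG NK Kk Ua act) δ))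

lemma3p3 : (d m : ℕ) (U : PSet (Fin d)) (V : PSet (Fin m)) (G : PSet (Fin d × Fin m)) →
           IsPermGroup U → IsPermGroup V → IsPermGroup G →
           IsTypeC U →
           G ⊆ₚ InWreath U V →
           IsTransitive G → SurjectsOnto G V → BlockStabOnto G U →
           (δ₀ : Fin d) (j₀ : Fin m) →
           ¬ Trivial (Core G (BlockStab G j₀)) →
           (N : PSet (Fin d × Fin m)) → IsMinimalNormal N G →
           Trivial (N ∩ₚ Core G (BlockStab G j₀)) →
           ((PointStab G δ₀ j₀ ·ₚ N) ⊆ₚ (BlockStab G j₀ ·ₚ N)) ×
           ¬ ((BlockStab G j₀ ·ₚ N) ⊆ₚ (PointStab G δ₀ j₀ ·ₚ N)) ×
           ¬ ((PointStab G δ₀ j₀ ·ₚ N) ⊆ₚ BlockStab G j₀) ×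
           ¬ (BlockStab G j₀ ⊆ₚ (PointStab G δ₀ j₀ ·ₚ N))
lemma3p3 d m U V G gU _ gG typeC wr trG _ onto δ₀ j₀ Knt N minN NK =
  G₁N⊆G₀N , G₀N⊈G₁N , G₁N⊈G₀ , G₀⊈G₁N
  where
    G₀ G₁ : PSet (Fin d × Fin m)
    G₀ = BlockStab G j₀
    G₁ = PointStab G δ₀ j₀
    nN : IsNormal N G
    nN = IsMinimalNormal.normal minN
    G₁N⊆G₀N : (G₁ ·ₚ N) ⊆ₚ (G₀ ·ₚ N)
    G₁N⊆G₀N g (p , n , G₁p , Nn , g≈pn) = p , n , WreathBlocks.pointStab⊆blockStab {U = U} {V = V} wr δ₀ j₀ p G₁p , Nn , g≈pn
    G₀⊈G₁N : ¬ (G₀ ⊆ₚ (G₁ ·ₚ N))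
    G₀⊈G₁N = blockStab⊈pointStab·N gU gG wr onto nN j₀ typeC trG δ₀ Knt NK
    G₀N⊈G₁N : ¬ ((G₀ ·ₚ N) ⊆ₚ (G₁ ·ₚ N))
    G₀N⊈G₁N G₀N⊆G₁N = G₀⊈G₁N λ g G₀g →
      G₀N⊆G₁N g (g , idP , G₀g , IsPermGroup.id∈ (IsNormal.group nN) , λ _ → refl)
    -- G₁N ⊆ G₀ puts N inside G₀, hence inside its core K, so N = N ∩ K = 1.
    G₁N⊈G₀ : ¬ ((G₁ ·ₚ N) ⊆ₚ G₀)
    G₁N⊈G₀ G₁N⊆G₀ = IsMinimalNormal.nontrivial minN λ n Nn → NK n (Nn , normal-in-core gG nN N⊆G₀ n Nn)
      where
        N⊆G₀ : N ⊆ₚ G₀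
        N⊆G₀ n Nn = G₁N⊆G₀ n (idP , n , (IsPermGroup.id∈ gG , refl) , Nn , λ _ → refl)
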